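{- Let $X$ be a finite set with $|X|\ge2$. A hierarchy $\mathcal{H}$ on $X$ and a partition $\mathcal{P}$ of $X$ are compatible if and only if the set $$\mathfrak{Y}(\mathcal{H},\mathcal{P})=\{A\in\mathcal{P} : \exists B\in\mathcal{P}\setminus\{A\}\text{ with } B\cap A_{\mathcal{H}}\neq\emptyset \text{ and } A_{\mathcal{H}}\subseteq B_{\mathcal{H}}\}$$ is empty.
   Context: A rooted phylogenetic tree $T$ on $X$ is a rooted tree with leaf set $X$ in which every non-leaf vertex has at least two children. A hierarchy on $X$ is a set system $\mathcal{H}\subseteq 2^X$ with $\emptyset\notin\mathcal{H}$, $X\in\mathcal{H}$, all singletons in $\mathcal{H}$, and no two members overlapping; it corresponds to the unique rooted phylogenetic tree $T$ with $\mathcal{H}=\{L(T(v)):v\in V(T)\}$. For nonempty $A\subseteq X$, $A_{\mathcal{H}}$ is the inclusion-minimal member of $\mathcal{H}$ containing $A$. For $H\subseteq E(T)$, $\mathcal{F}(T,H)$ is the partition of $X$ into leaf sets of the connected components of $T-H$; $\mathcal{P}$ and $\mathcal{H}$ are compatible if $\mathcal{P}=\mathcal{F}(T,H)$ for some $H\subseteq E(T)$. -}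

module Defs where

open import Data.Nat using (ℕ)
open import Data.Fin using (Fin)
open import Data.Fin.Subset using (Subset; _∈_; _⊆_; _⊂_; _∩_; ⁅_⁆; ⊤; ⊥; Nonempty; Empty)
open import Data.List using (List)
open import Data.List.Membership.Propositional renaming (_∈_ to _∈ˡ_; _∉_ to _∉ˡ_)
open import Data.List.Relation.Unary.All using (All)
open import Data.Product using (Σ; ∃; _×_; _,_)
open import Data.Sum using (_⊎_)
open import Relation.Nullary using (¬_)
open import Relation.Binary.PropositionalEquality using (_≡_; _≢_)
open import Relation.Binary.Construct.Closure.ReflexiveTransitive using (Star)
open import Function.Bundles using (_⇔_)

-- The finite set X is Fin n; subsets of X are Data.Fin.Subset; a set system
-- (hierarchy, partition) is given by a finite list of subsets (read as a set).

SetSystem : ℕ → Set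
SetSystem n = List (Subset n)

record IsHierarchy {n : ℕ} (H : SetSystem n) : Set where
  field
    empty∉    : ⊥ ∉ˡ H
    full∈     : ⊤ ∈ˡ H
    singleton∈ : (x : Fin n) → ⁅ x ⁆ ∈ˡ H
    noOverlap : ∀ {C D} → C ∈ˡ H → D ∈ˡ H → C ⊆ D ⊎ D ⊆ C ⊎ Empty (C ∩ D)

record IsPartition {n : ℕ} (P : SetSystem n) : Set where
  field
    blocksNonempty : ∀ {A} → A ∈ˡ P → Nonempty A
    disjoint : ∀ {A B} → A ∈ˡ P → B ∈ˡ P → A ≢ B → Empty (A ∩ B)
    cover    : (x : Fin n) → ∃ λ A → A ∈ˡ P × x ∈ A

-- C is an inclusion-minimal member of H containing A  (C = A_H).
IsMinCluster : {n : ℕ} → SetSystem n → Subset n → Subset n → Set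
IsMinCluster H A C =
  C ∈ˡ H × A ⊆ C × (∀ {D} → D ∈ˡ H → A ⊆ D → D ⊆ C → D ≡ C)

InY : {n : ℕ} → SetSystem n → SetSystem n → Subset n → Set
InY H P A =
  A ∈ˡ P × (∃ λ B → B ∈ˡ P × B ≢ A ×
    (∃ λ AH → ∃ λ BH → IsMinCluster H A AH × IsMinCluster H B BH ×
       Nonempty (B ∩ AH) × AH ⊆ BH))

YEmpty : {n : ℕ} → SetSystem n → SetSystem n → Set
YEmpty H P = ∀ A → ¬ InY H P A

-- The rooted phylogenetic tree T of H: vertices are the members of H (the
-- leaf x is the vertex ⁅ x ⁆), and (C , D) is an edge from parent C to child D
-- iff D ⊂ C and no member of H lies strictly between them (Hasse diagram).
IsEdge : {n : ℕ} → SetSystem n → Subset n × Subset n → Set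
IsEdge H (C , D) =
  C ∈ˡ H × D ∈ˡ H × D ⊂ C × (∀ {E} → E ∈ˡ H → D ⊂ E → E ⊂ C → Data.Empty.⊥)
  where import Data.Empty

Adj : {n : ℕ} → SetSystem n → List (Subset n × Subset n) → Subset n → Subset n → Set
Adj H Cut u v =
  (IsEdge H (u , v) × (u , v) ∉ˡ Cut) ⊎ (IsEdge H (v , u) × (v , u) ∉ˡ Cut)

Connected : {n : ℕ} → SetSystem n → List (Subset n × Subset n) → Subset n → Subset n → Set
Connected H Cut = Star (Adj H Cut)

IsForestPartition : {n : ℕ} → SetSystem n → List (Subset n × Subset n) → SetSystem n → Set
IsForestPartition H Cut P =
  ∀ B → B ∈ˡ P ⇔ (Nonempty B × ∃ λ v → v ∈ˡ H × (∀ x → (x ∈ B ⇔ Connected H Cut v ⁅ x ⁆)))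

Compatible : {n : ℕ} → SetSystem n → SetSystem n → Set
Compatible H P = ∃ λ Cut → All (IsEdge H) Cut × IsForestPartition H Cut P

-- Compatible ⇒ 𝔜 empty: every block A is the leaf set of a component of T − Cut
-- containing a vertex t ⊇ A, hence t ⊇ A_H.  A path in a tree from a leaf of a
-- cluster K to a vertex above K passes through K, so A_H lies in the component
-- of A; if moreover b ∈ B ∩ A_H and A_H ⊆ B_H, the same argument puts A_H in the
-- component of B, forcing b ∈ A, which contradicts disjointness.
--
-- 𝔜 empty ⇒ compatible: keep exactly the edges both of whose ends lie below A_H
-- and meet A, for some block A.  When 𝔜 is empty such an A is unique for every
-- vertex, so it is constant along paths of T − Cut, while every cluster of
-- T(A_H) meeting A climbs to A_H through kept edges.  Hence the component of
-- A_H has leaf set exactly A.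

module Submission where

open import Defs
open import Data.Nat using (ℕ; _≤_; zero; suc; _+_)
open import Data.Nat.Properties using (<⇒≱; ≤-trans; ≤-reflexive; +-suc; +-monoʳ-≤; m≤m+n)
open import Data.Fin using (Fin)
import Data.Fin.Properties as Fin
open import Data.Fin.Subset using (Subset; _∈_; _⊆_; _⊂_; _∩_; ⁅_⁆; Nonempty; ∣_∣)
open import Data.Fin.Subset.Properties
  using (_∈?_; _⊆?_; _⊂?_; nonempty?; Empty-unique; ⊆-refl; ⊆-reflexive; ⊆-trans; ⊆-antisym; ⊆⊤;
         p⊂q⇒p⊆q; ⊂-⊆-trans; ⊂-irref; p⊂q⇒∣p∣<∣q∣; x∈⁅x⁆; x∈⁅y⁆⇒x≡y; x∈p∩q⁺; x∈p∩q⁻;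
         ⊂-decStrictPartialOrder)
open import Data.List using (List; []; _∷_; filter; cartesianProduct; allFin)
open import Data.List.Membership.Propositional using (find; lose) renaming (_∈_ to _∈ˡ_; _∉_ to _∉ˡ_)
open import Data.List.Membership.Propositional.Properties
  using (∈-filter⁺; ∈-filter⁻; ∈-cartesianProduct⁺; ∈-cartesianProduct⁻; ∈-allFin)
open import Data.List.Relation.Unary.Any using (Any; here; there; any?)
open import Data.List.Relation.Unary.All as All using (All; []; _∷_; all?)
open import Data.Product using (∃; _×_; _,_; proj₁; proj₂)
open import Data.Sum using (_⊎_; inj₁; inj₂; swap)
open import Data.Empty using (⊥-elim)
open import Function using (_∘_; id)
open import Level using (0ℓ)
open import Function.Bundles using (_⇔_; mk⇔; Equivalence)
open import Relation.Binary.Bundles using (DecStrictPartialOrder)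
open import Relation.Binary.PropositionalEquality using (_≡_; _≢_; refl; sym; subst)
open import Relation.Binary.Construct.Closure.ReflexiveTransitive using (ε; _◅_; _◅◅_; reverse)
open import Relation.Nullary using (¬_; Dec; yes; no; ¬?)
open import Relation.Nullary.Decidable using (_×-dec_; _→-dec_)
open import Relation.Unary using (Pred; Decidable)

open Equivalence using (to; from)

private
  variable
    n : ℕ
    x : Fin n
    p q : Subset n

⊆⇒≡⊎⊂ : p ⊆ q → p ≡ q ⊎ p ⊂ q
⊆⇒≡⊎⊂ {p = p} {q = q} p⊆q with Fin.any? (λ x → (x ∈? q) ×-dec ¬? (x ∈? p))
... | yes (x , x∈q , x∉p) = inj₂ (p⊆q , x , x∈q , x∉p)
... | no ¬witness = inj₁ (⊆-antisym p⊆q q⊆p)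
  where
  q⊆p : q ⊆ p
  q⊆p {x} x∈q with x ∈? p
  ... | yes x∈p = x∈p
  ... | no x∉p = ⊥-elim (¬witness (x , x∈q , x∉p))

x∈p⇒⁅x⁆⊆p : x ∈ p → ⁅ x ⁆ ⊆ p
x∈p⇒⁅x⁆⊆p {x = x} {p = p} x∈p y∈⁅x⁆ = subst (_∈ p) (sym (x∈⁅y⁆⇒x≡y x y∈⁅x⁆)) x∈p

least-of-chain : (C : Subset n) (Cs : List (Subset n)) →
  (∀ {D E} → D ∈ˡ C ∷ Cs → E ∈ˡ C ∷ Cs → D ⊆ E ⊎ E ⊆ D) →
  ∃ λ L → L ∈ˡ C ∷ Cs × All (L ⊆_) (C ∷ Cs)
least-of-chain C [] _ = C , here refl , ⊆-refl ∷ []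
least-of-chain C (C′ ∷ Cs) chain with least-of-chain C′ Cs (λ D∈ E∈ → chain (there D∈) (there E∈))
... | L , L∈ , L⊆ with chain (here refl) (there L∈)
...   | inj₁ C⊆L = C , here refl , ⊆-refl ∷ All.map (⊆-trans C⊆L) L⊆
...   | inj₂ L⊆C = L , there L∈ , L⊆C ∷ L⊆

module Hierarchy {H : SetSystem n} (hH : IsHierarchy H) where
  open IsHierarchy hH

  member-nonempty : ∀ {C} → C ∈ˡ H → Nonempty C
  member-nonempty {C} C∈H with nonempty? C
  ... | yes ne = ne
  ... | no ¬ne = ⊥-elim (empty∉ (subst (_∈ˡ H) (Empty-unique ¬ne) C∈H))

  comparable : ∀ {C D} → C ∈ˡ H → D ∈ˡ H → x ∈ C → x ∈ D → C ⊆ D ⊎ D ⊆ C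
  comparable C∈H D∈H x∈C x∈D with noOverlap C∈H D∈H
  ... | inj₁ C⊆D = inj₁ C⊆D
  ... | inj₂ (inj₁ D⊆C) = inj₂ D⊆C
  ... | inj₂ (inj₂ disjoint) = ⊥-elim (disjoint (_ , x∈p∩q⁺ (x∈C , x∈D)))

  least-cluster : ∀ {A K} {Q : Pred (Subset n) 0ℓ} → Decidable Q → (∀ {E} → Q E → A ⊆ E) →
    Nonempty A → K ∈ˡ H → Q K → ∃ λ C → C ∈ˡ H × Q C × (∀ {E} → E ∈ˡ H → Q E → C ⊆ E)
  least-cluster {A} {K} {Q} Q? Q⇒⊇A (a , a∈A) K∈H QK =
    let C , C∈ , C⊆ = least-of-chain K (filter Q? H) chain
        C∈H , QC = candidate C∈
    in C , C∈H , QC , λ E∈H QE → All.lookup C⊆ (there (∈-filter⁺ Q? E∈H QE))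
    where
    candidate : ∀ {E} → E ∈ˡ K ∷ filter Q? H → E ∈ˡ H × Q E
    candidate (here refl) = K∈H , QK
    candidate (there E∈) = ∈-filter⁻ Q? E∈

    chain : ∀ {D E} → D ∈ˡ K ∷ filter Q? H → E ∈ˡ K ∷ filter Q? H → D ⊆ E ⊎ E ⊆ D
    chain D∈ E∈ with candidate D∈ | candidate E∈
    ... | D∈H , QD | E∈H , QE = comparable D∈H E∈H (Q⇒⊇A QD a∈A) (Q⇒⊇A QE a∈A)

  min-cluster : ∀ {A} → Nonempty A → ∃ (IsMinCluster H A)
  min-cluster {A} ne with least-cluster (A ⊆?_) id ne full∈ ⊆⊤
  ... | C , C∈H , A⊆C , least = C , C∈H , A⊆C , λ D∈H A⊆D D⊆C → ⊆-antisym D⊆C (least D∈H A⊆D)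

  min-cluster-least : ∀ {A C E} → Nonempty A → IsMinCluster H A C → E ∈ˡ H → A ⊆ E → C ⊆ E
  min-cluster-least (a , a∈A) (C∈H , A⊆C , minimal) E∈H A⊆E
    with comparable C∈H E∈H (A⊆C a∈A) (A⊆E a∈A)
  ... | inj₁ C⊆E = C⊆E
  ... | inj₂ E⊆C = ⊆-reflexive (sym (minimal E∈H A⊆E E⊆C))

  parent : ∀ {D K} → D ∈ˡ H → Nonempty D → D ⊂ K → K ∈ˡ H → ∃ λ E → IsEdge H (E , D) × E ⊆ K
  parent {D} D∈H ne D⊂K K∈H with least-cluster (D ⊂?_) p⊂q⇒p⊆q ne K∈H D⊂K
  ... | E , E∈H , D⊂E , least =
    E , (E∈H , D∈H , D⊂E , λ F∈H D⊂F F⊂E → ⊂-irref refl (⊂-⊆-trans F⊂E (least F∈H D⊂F))) ,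
    least K∈H D⊂K

  module TreePaths (Cut : List (Subset n × Subset n)) where

    _~_ : Subset n → Subset n → Set
    _~_ = Connected H Cut

    ~-sym : ∀ {u w} → u ~ w → w ~ u
    ~-sym = reverse swap

    adj-target∈H : ∀ {u w} → Adj H Cut u w → w ∈ˡ H
    adj-target∈H (inj₁ ((_ , w∈H , _) , _)) = w∈H
    adj-target∈H (inj₂ ((w∈H , _) , _)) = w∈H

    upper-bound : ∀ {u w} → u ∈ˡ H → u ~ w → ∃ λ t → t ∈ˡ H × u ~ t × u ⊆ t × w ⊆ t
    upper-bound u∈H ε = _ , u∈H , ε , ⊆-refl , ⊆-refl
    upper-bound u∈H (step ◅ path) with upper-bound (adj-target∈H step) path
    upper-bound u∈H (step@(inj₂ ((_ , _ , u⊂u′ , _) , _)) ◅ _) | t , t∈H , u′~t , u′⊆t , w⊆t =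
      t , t∈H , step ◅ u′~t , ⊆-trans (p⊂q⇒p⊆q u⊂u′) u′⊆t , w⊆t
    upper-bound u∈H (step@(inj₁ ((_ , u′∈H , u′⊂u , _) , _)) ◅ _) | t , t∈H , u′~t , u′⊆t , w⊆t
      with member-nonempty u′∈H
    ... | y , y∈u′ with comparable u∈H t∈H (p⊂q⇒p⊆q u′⊂u y∈u′) (u′⊆t y∈u′)
    ...   | inj₁ u⊆t = t , t∈H , step ◅ u′~t , u⊆t , w⊆t
    ...   | inj₂ t⊆u = _ , u∈H , ε , ⊆-refl , ⊆-trans w⊆t t⊆u

    exiting-edge-starts-at : ∀ {E u u′} → E ∈ˡ H → Adj H Cut u u′ → u ⊆ E → ¬ u′ ⊆ E → u ≡ E
    exiting-edge-starts-at E∈H (inj₁ ((_ , _ , u′⊂u , _) , _)) u⊆E u′⊈E =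
      ⊥-elim (u′⊈E (⊆-trans (p⊂q⇒p⊆q u′⊂u) u⊆E))
    exiting-edge-starts-at E∈H (inj₂ ((u′∈H , u∈H , u⊂u′ , nothing-between) , _)) u⊆E u′⊈E
      with member-nonempty u∈H
    ... | y , y∈u with comparable u′∈H E∈H (p⊂q⇒p⊆q u⊂u′ y∈u) (u⊆E y∈u)
    ...   | inj₁ u′⊆E = ⊥-elim (u′⊈E u′⊆E)
    ...   | inj₂ E⊆u′ with ⊆⇒≡⊎⊂ u⊆E | ⊆⇒≡⊎⊂ E⊆u′
    ...     | inj₁ u≡E | _ = u≡E
    ...     | inj₂ _ | inj₁ refl = ⊥-elim (u′⊈E ⊆-refl)
    ...     | inj₂ u⊂E | inj₂ E⊂u′ = ⊥-elim (nothing-between E∈H u⊂E E⊂u′)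

    path-exits-through : ∀ {E u w} → E ∈ˡ H → u ~ w → u ⊆ E → ¬ w ⊆ E → E ~ w
    path-exits-through E∈H ε u⊆E w⊈E = ⊥-elim (w⊈E u⊆E)
    path-exits-through {E} {w = w} E∈H (_◅_ {j = u′} step path) u⊆E w⊈E with u′ ⊆? E
    ... | yes u′⊆E = path-exits-through E∈H path u′⊆E w⊈E
    ... | no u′⊈E = subst (_~ w) (exiting-edge-starts-at E∈H step u⊆E u′⊈E) (step ◅ path)

    path-through-cluster : ∀ {K t} → K ∈ˡ H → ⁅ x ⁆ ~ t → x ∈ K → K ⊆ t → K ~ t
    path-through-cluster {K = K} {t} K∈H x~t x∈K K⊆t with t ⊆? K
    ... | yes t⊆K = subst (K ~_) (⊆-antisym K⊆t t⊆K) ε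
    ... | no t⊈K = path-exits-through K∈H x~t (x∈p⇒⁅x⁆⊆p x∈K) t⊈K

    component-bound : ∀ {v} → v ∈ˡ H → (S : Subset n) → (∀ {x} → x ∈ S → v ~ ⁅ x ⁆) →
      ∃ λ t → t ∈ˡ H × v ~ t × S ⊆ t
    component-bound {v} v∈H S reach =
      let t , t∈H , v~t , bound = collect (allFin _)
      in t , t∈H , v~t , λ x∈S → bound (∈-allFin _) x∈S
      where
      collect : (xs : List (Fin n)) → ∃ λ t → t ∈ˡ H × v ~ t × (∀ {x} → x ∈ˡ xs → x ∈ S → x ∈ t)
      collect [] = v , v∈H , ε , λ ()
      collect (x ∷ xs) with collect xs | x ∈? S
      ... | t , t∈H , v~t , bound | no x∉S = t , t∈H , v~t , λ
        { (here refl) x∈S → ⊥-elim (x∉S x∈S)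
        ; (there y∈xs) → bound y∈xs }
      ... | t , t∈H , v~t , bound | yes x∈S with upper-bound t∈H (~-sym v~t ◅◅ reach x∈S)
      ...   | t′ , t′∈H , t~t′ , t⊆t′ , x⊆t′ = t′ , t′∈H , v~t ◅◅ t~t′ , λ
        { (here refl) _ → x⊆t′ (x∈⁅x⁆ x)
        ; (there y∈xs) y∈S → t⊆t′ (bound y∈xs y∈S) }

    LeafSetOf : Subset n → Subset n → Set
    LeafSetOf v X = ∀ x → x ∈ X ⇔ v ~ ⁅ x ⁆

    component-top : ∀ {v X} → v ∈ˡ H → LeafSetOf v X → ∃ λ t → t ∈ˡ H × X ⊆ t × LeafSetOf t X
    component-top {X = X} v∈H members with component-bound v∈H X (to (members _))
    ... | t , t∈H , v~t , X⊆t = t , t∈H , X⊆t , λ x →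
      mk⇔ (λ x∈X → ~-sym v~t ◅◅ to (members x) x∈X) (λ t~x → from (members x) (v~t ◅◅ t~x))

    leaf-sets-meeting⇒≡ : ∀ {v w X Y} → LeafSetOf v X → LeafSetOf w Y → x ∈ X → x ∈ Y → X ≡ Y
    leaf-sets-meeting⇒≡ {x = b} X-leaves Y-leaves b∈X b∈Y = ⊆-antisym
      (λ {x} x∈X → from (Y-leaves x) (w~b ◅◅ ~-sym v~b ◅◅ to (X-leaves x) x∈X))
      (λ {x} x∈Y → from (X-leaves x) (v~b ◅◅ ~-sym w~b ◅◅ to (Y-leaves x) x∈Y))
      where
      v~b = to (X-leaves b) b∈X
      w~b = to (Y-leaves b) b∈Y

    nested-cluster-leaf∈block : ∀ {P : SetSystem n} {A B AH BH b} → IsForestPartition H Cut P →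
      A ∈ˡ P → B ∈ˡ P → IsMinCluster H A AH → IsMinCluster H B BH →
      b ∈ B → b ∈ AH → AH ⊆ BH → b ∈ A
    nested-cluster-leaf∈block {A = A} {B} {AH} {b = b}
      fp A∈P B∈P A-min@(AH∈H , A⊆AH , _) B-min b∈B b∈AH AH⊆BH
      with to (fp A) A∈P | to (fp B) B∈P
    ... | (a , a∈A) , _ , vA∈H , A-leaves | _ , _ , vB∈H , B-leaves
      with component-top vA∈H A-leaves | component-top vB∈H B-leaves
    ...   | tA , tA∈H , A⊆tA , A-leaves′ | tB , tB∈H , B⊆tB , B-leaves′ =
      from (A-leaves′ b) (~-sym AH~tA ◅◅ AH~tB ◅◅ to (B-leaves′ b) b∈B)
      where
      AH~tA : AH ~ tA
      AH~tA = path-through-cluster AH∈H (~-sym (to (A-leaves′ a) a∈A)) (A⊆AH a∈A)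
        (min-cluster-least (a , a∈A) A-min tA∈H A⊆tA)
      AH~tB : AH ~ tB
      AH~tB = path-through-cluster AH∈H (~-sym (to (B-leaves′ b) b∈B)) b∈AH
        (⊆-trans AH⊆BH (min-cluster-least (b , b∈B) B-min tB∈H B⊆tB))

module Compatibility {H P : SetSystem n} (hH : IsHierarchy H) (hP : IsPartition P) where
  open IsHierarchy hH
  open IsPartition hP
  open Hierarchy hH
  open DecStrictPartialOrder (⊂-decStrictPartialOrder n) using (_≟_)

  compatible⇒YEmpty : Compatible H P → YEmpty H P
  compatible⇒YEmpty (_ , _ , fp) A
    (A∈P , B , B∈P , B≢A , _ , _ , A-min , B-min , (b , b∈B∩AH) , AH⊆BH)
    with x∈p∩q⁻ B _ b∈B∩AH
  ... | b∈B , b∈AH = disjoint A∈P B∈P (B≢A ∘ sym)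
    (b , x∈p∩q⁺ (TreePaths.nested-cluster-leaf∈block _ fp A∈P B∈P A-min B-min b∈B b∈AH AH⊆BH , b∈B))

  -- Span A u: u is a vertex of T(A_H) whose cluster meets A.  This avoids
  -- choosing A_H, so that it is decidable for every A.
  Span : Subset n → Subset n → Set
  Span A u = Nonempty (u ∩ A) × All (λ E → A ⊆ E → u ⊆ E) H

  span? : ∀ A u → Dec (Span A u)
  span? A u = nonempty? (u ∩ A) ×-dec all? (λ E → A ⊆? E →-dec u ⊆? E) H

  span⇒⊆ : ∀ {A u AH} → Span A u → IsMinCluster H A AH → u ⊆ AH
  span⇒⊆ (_ , below) (AH∈H , A⊆AH , _) = All.lookup below AH∈H A⊆AH

  ⊆⇒span : ∀ {A u AH} → IsMinCluster H A AH → Nonempty (u ∩ A) → u ⊆ AH → Span A u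
  ⊆⇒span {A} {u} A-min meets@(y , y∈u∩A) u⊆AH =
    meets , All.tabulate λ E∈H A⊆E →
      ⊆-trans u⊆AH (min-cluster-least (y , proj₂ (x∈p∩q⁻ u A y∈u∩A)) A-min E∈H A⊆E)

  Kept : Subset n × Subset n → Set
  Kept (C , D) = Any (λ A → Span A C × Span A D) P

  kept? : Decidable Kept
  kept? (C , D) = any? (λ A → span? A C ×-dec span? A D) P

  Severed : Subset n × Subset n → Set
  Severed (C , D) = D ⊂ C × All (λ E → ¬ (D ⊂ E × E ⊂ C)) H × ¬ Kept (C , D)

  severed? : Decidable Severed
  severed? (C , D) = D ⊂? C ×-dec all? (λ E → ¬? (D ⊂? E ×-dec E ⊂? C)) H
    ×-dec ¬? (kept? (C , D))

  severedCut : List (Subset n × Subset n)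
  severedCut = filter severed? (cartesianProduct H H)

  severed⇒edge : ∀ {e} → e ∈ˡ severedCut → IsEdge H e
  severed⇒edge e∈Cut with ∈-filter⁻ severed? {xs = cartesianProduct H H} e∈Cut
  ... | e∈H×H , D⊂C , nothing-between , _ with ∈-cartesianProduct⁻ H H e∈H×H
  ...   | C∈H , D∈H = C∈H , D∈H , D⊂C , λ E∈H D⊂E E⊂C → All.lookup nothing-between E∈H (D⊂E , E⊂C)

  kept⇒not-severed : ∀ {e} → Kept e → e ∉ˡ severedCut
  kept⇒not-severed kept e∈Cut with ∈-filter⁻ severed? {xs = cartesianProduct H H} e∈Cut
  ... | _ , _ , _ , ¬kept = ¬kept kept

  not-severed⇒kept : ∀ {e} → IsEdge H e → e ∉ˡ severedCut → Kept e
  not-severed⇒kept {C , D} edge@(C∈H , D∈H , D⊂C , nothing-between) e∉Cut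
    with kept? (C , D)
  ... | yes kept = kept
  ... | no ¬kept = ⊥-elim (e∉Cut (∈-filter⁺ severed? (∈-cartesianProduct⁺ C∈H D∈H)
    (D⊂C , All.tabulate (λ E∈H (D⊂E , E⊂C) → nothing-between E∈H D⊂E E⊂C) , ¬kept)))

  open TreePaths severedCut

  module _ (Y-empty : YEmpty H P) where

    nested⇒InY : ∀ {A B u AH BH} → A ∈ˡ P → B ∈ˡ P → B ≢ A → Span A u → Span B u →
      IsMinCluster H A AH → IsMinCluster H B BH → AH ⊆ BH → InY H P A
    nested⇒InY {B = B} {u} A∈P B∈P B≢A A-span ((z , z∈u∩B) , _) A-min B-min AH⊆BH
      with x∈p∩q⁻ u B z∈u∩B
    ... | z∈u , z∈B =
      A∈P , B , B∈P , B≢A , _ , _ , A-min , B-min ,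
      (z , x∈p∩q⁺ (z∈B , span⇒⊆ A-span A-min z∈u)) , AH⊆BH

    span-unique : ∀ {A B u} → A ∈ˡ P → B ∈ˡ P → Span A u → Span B u → A ≡ B
    span-unique {A} {B} {u} A∈P B∈P A-span@((y , y∈u∩A) , _) B-span with A ≟ B
    ... | yes A≡B = A≡B
    ... | no A≢B
      with min-cluster (blocksNonempty A∈P) | min-cluster (blocksNonempty B∈P) | x∈p∩q⁻ u A y∈u∩A
    ...   | _ , A-min | _ , B-min | y∈u , _
      with comparable (proj₁ A-min) (proj₁ B-min) (span⇒⊆ A-span A-min y∈u) (span⇒⊆ B-span B-min y∈u)
    ...     | inj₁ AH⊆BH =
      ⊥-elim (Y-empty A (nested⇒InY A∈P B∈P (A≢B ∘ sym) A-span B-span A-min B-min AH⊆BH))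
    ...     | inj₂ BH⊆AH =
      ⊥-elim (Y-empty B (nested⇒InY B∈P A∈P A≢B B-span A-span B-min A-min BH⊆AH))

    adj-kept : ∀ {u w} → Adj H severedCut u w → ∃ λ A → A ∈ˡ P × Span A u × Span A w
    adj-kept (inj₁ (edge , e∉Cut)) = find (not-severed⇒kept edge e∉Cut)
    adj-kept (inj₂ (edge , e∉Cut)) =
      let A , A∈P , w-span , u-span = find (not-severed⇒kept edge e∉Cut) in A , A∈P , u-span , w-span

    span-preserved : ∀ {B u w} → B ∈ˡ P → u ~ w → Span B u → Span B w
    span-preserved B∈P ε B-span = B-span
    span-preserved B∈P (step ◅ path) B-span with adj-kept step
    ... | A , A∈P , u-span , w-span =
      span-preserved B∈P path (subst (λ X → Span X _) (span-unique A∈P B∈P u-span B-span) w-span)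

    -- k bounds ∣ BH ∣ − ∣ D ∣, making the climb to the root structurally recursive.
    climb : ∀ {B BH D} → B ∈ˡ P → IsMinCluster H B BH → x ∈ B → (k : ℕ) →
      D ∈ˡ H → x ∈ D → D ⊆ BH → ∣ BH ∣ ≤ k + ∣ D ∣ → D ~ BH
    climb {x = x} {B} {BH} B∈P B-min x∈B k D∈H x∈D D⊆BH size with ⊆⇒≡⊎⊂ D⊆BH
    ... | inj₁ refl = ε
    ... | inj₂ D⊂BH with parent D∈H (_ , x∈D) D⊂BH (proj₁ B-min)
    ...   | E , edge@(E∈H , _ , D⊂E , _) , E⊆BH with k
    ...     | zero = ⊥-elim (<⇒≱ (p⊂q⇒∣p∣<∣q∣ D⊂BH) size)
    ...     | suc k =
      inj₂ (edge , kept⇒not-severed (lose B∈P (meets-below E⊆BH x∈E , meets-below D⊆BH x∈D))) ◅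
      climb B∈P B-min x∈B k E∈H x∈E E⊆BH size′
      where
      x∈E : x ∈ E
      x∈E = p⊂q⇒p⊆q D⊂E x∈D
      meets-below : ∀ {F} → F ⊆ BH → x ∈ F → Span B F
      meets-below F⊆BH x∈F = ⊆⇒span B-min (_ , x∈p∩q⁺ (x∈F , x∈B)) F⊆BH
      size′ : ∣ BH ∣ ≤ k + ∣ E ∣
      size′ = ≤-trans size (≤-trans (≤-reflexive (sym (+-suc k _))) (+-monoʳ-≤ k (p⊂q⇒∣p∣<∣q∣ D⊂E)))

    block-leaves : ∀ {B BH} → B ∈ˡ P → IsMinCluster H B BH → LeafSetOf BH B
    block-leaves {B} {BH} B∈P B-min@(_ , B⊆BH , _) x = mk⇔
      (λ x∈B → ~-sym (climb B∈P B-min x∈B _ (singleton∈ x) (x∈⁅x⁆ x)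
                              (x∈p⇒⁅x⁆⊆p (B⊆BH x∈B)) (m≤m+n _ _)))
      (λ BH~x → leaf∈B (proj₁ (span-preserved B∈P BH~x root-span)))
      where
      root-span : Span B BH
      root-span with blocksNonempty B∈P
      ... | b , b∈B = ⊆⇒span B-min (b , x∈p∩q⁺ (B⊆BH b∈B , b∈B)) ⊆-refl
      leaf∈B : Nonempty (⁅ x ⁆ ∩ B) → x ∈ B
      leaf∈B (y , y∈⁅x⁆∩B) with x∈p∩q⁻ ⁅ x ⁆ B y∈⁅x⁆∩B
      ... | y∈⁅x⁆ , y∈B = subst (_∈ B) (x∈⁅y⁆⇒x≡y x y∈⁅x⁆) y∈B

    severedCut-forest : IsForestPartition H severedCut P
    severedCut-forest X = mk⇔ block⇒component component⇒block
      where
      block⇒component : X ∈ˡ P → Nonempty X × ∃ λ v → v ∈ˡ H × LeafSetOf v X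
      block⇒component X∈P with min-cluster (blocksNonempty X∈P)
      ... | XH , X-min = blocksNonempty X∈P , XH , proj₁ X-min , block-leaves X∈P X-min
      component⇒block : Nonempty X × (∃ λ v → v ∈ˡ H × LeafSetOf v X) → X ∈ˡ P
      component⇒block ((b , b∈X) , _ , _ , X-leaves) with cover b
      ... | A , A∈P , b∈A with min-cluster (blocksNonempty A∈P)
      ...   | _ , A-min =
        subst (_∈ˡ P) (leaf-sets-meeting⇒≡ (block-leaves A∈P A-min) X-leaves b∈A b∈X) A∈P

  YEmpty⇒compatible : YEmpty H P → Compatible H P
  YEmpty⇒compatible Y-empty =
    severedCut , All.tabulate severed⇒edge , severedCut-forest Y-empty

proposition5p3 : (n : ℕ) → 2 ≤ n → (H P : SetSystem n) →
    IsHierarchy H → IsPartition P → (Compatible H P ⇔ YEmpty H P)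
proposition5p3 n _ H P hH hP = mk⇔ compatible⇒YEmpty YEmpty⇒compatible
  where open Compatibility hH hP
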